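{- Let $G$ be a graph on $n$ vertices with $\underline{f}(G)\ge 3$. If \[ \beta\ge\max\left\{\frac{1}{3}-\frac{\underline{f}(G)-3}{3(\underline{f}(G)+3\gamma_P(G)-6)},\ \frac{\gamma_P(G)}{n}\right\}, \] then every minimum power dominating set of $G$ is $\beta$-best.
   Context: Graphs are finite and simple. Power domination: from $S\subseteq V(G)$, first $N[S]$ is observed; then repeatedly, while an observed vertex has exactly one unobserved neighbor, that neighbor becomes observed; the final set is $\mathrm{Obs}(G;S)$. $S$ is a power dominating set if $\mathrm{Obs}(G;S)=V(G)$; $\gamma_P(G)$ is the minimum size of one. For $\beta\ge0$, $\mathrm{C}(G;S,\beta)=|S|+\beta(|V(G)|-|\mathrm{Obs}(G;S)|)$; $S$ is $\beta$-best if it minimizes $\mathrm{C}(G;\cdot,\beta)$ over all subsets of $V(G)$. A fort is a nonempty $F\subseteq V(G)$ such that no vertex of $V(G)\setminus F$ has exactly one neighbor in $F$; $\underline{f}(G)$ is the minimum size of a fort. -}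

module Defs where

open import Data.Bool using (Bool; true; false; _∧_; _∨_; not; T)
open import Data.Nat as ℕ using (ℕ; zero; suc; _∸_; _≤_)
open import Data.Integer using (+_)
open import Data.Fin using (Fin; _≟_)
open import Data.Fin.Subset using (Subset; _∈_; _∉_; ∣_∣)
open import Data.Vec using (tabulate; lookup)
open import Data.List using (allFin)
open import Data.Bool.ListAction using (any; all)
open import Data.Product using (∃; _×_)
open import Relation.Nullary using (¬_; does)
open import Relation.Binary.PropositionalEquality using (_≡_; _≢_)
open import Data.Rational using (ℚ; _/_; _+_; _*_; _-_; 0ℚ)
import Data.Rational as Q

record Graph (n : ℕ) : Set where
  field
    adj   : Fin n → Fin n → Bool
    sym   : ∀ u v → adj u v ≡ adj v u
    irrefl : ∀ v → adj v v ≡ false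
open Graph public

module _ {n : ℕ} (G : Graph n) where

  mem : Subset n → Fin n → Bool
  mem S v = lookup S v

  closedNbhd : Subset n → Subset n
  closedNbhd S = tabulate λ v →
    mem S v ∨ any (λ u → mem S u ∧ adj G u v) (allFin n)

  forces : Subset n → Fin n → Fin n → Bool
  forces O u v = mem O u ∧ adj G u v ∧ not (mem O v) ∧
    all (λ w → not (adj G u w) ∨ does (w ≟ v) ∨ mem O w) (allFin n)

  -- one (parallel) round of propagation; the forcing rule is monotone,
  -- so parallel and sequential application yield the same closure
  step : Subset n → Subset n
  step O = tabulate λ v → mem O v ∨ any (λ u → forces O u v) (allFin n)

  iter : ℕ → Subset n → Subset n
  iter zero O = O
  iter (suc k) O = iter k (step O)

  -- Obs(G;S): each round adds a vertex or reaches the fixed point,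
  -- so n rounds suffice
  Obs : Subset n → Subset n
  Obs S = iter n (closedNbhd S)

  IsPDS : Subset n → Set
  IsPDS S = ∀ v → v ∈ Obs S

  IsPowerDomNumber : ℕ → Set
  IsPowerDomNumber g = (∃ λ S → IsPDS S × ∣ S ∣ ≡ g)
                     × (∀ S → IsPDS S → g ≤ ∣ S ∣)

  IsMinPDS : Subset n → Set
  IsMinPDS S = IsPDS S × (∀ S′ → IsPDS S′ → ∣ S ∣ ≤ ∣ S′ ∣)

  nbrsIn : Subset n → Fin n → ℕ
  nbrsIn F v = ∣ tabulate (λ u → adj G v u ∧ mem F u) ∣

  IsFort : Subset n → Set
  IsFort F = (∃ λ v → v ∈ F) × (∀ v → v ∉ F → nbrsIn F v ≢ 1)

  IsMinFortSize : ℕ → Set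
  IsMinFortSize f = (∃ λ F → IsFort F × ∣ F ∣ ≡ f)
                  × (∀ F → IsFort F → f ≤ ∣ F ∣)

  ℕ→ℚ : ℕ → ℚ
  ℕ→ℚ k = + k / 1

  cost : Subset n → ℚ → ℚ
  cost S β = ℕ→ℚ ∣ S ∣ + β * ℕ→ℚ (n ∸ ∣ Obs S ∣)

  IsBetaBest : ℚ → Subset n → Set
  IsBetaBest β S = ∀ S′ → cost S β Q.≤ cost S′ β

-- a / d as a rational, with the convention a / 0 = 0
-- (only reached in the statement when the numerator is 0)
frac : ℕ → ℕ → ℚ
frac a zero = 0ℚ
frac a (suc d) = + a / suc d

module Submission where

-- Let S be a minimum power dominating set, so that C(G;S,β) = γ, and let S′ be any set, with
-- k = |S′| and u unobserved vertices. The unobserved vertices of S′ form a fort. While it is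
-- nonempty, some vertex z observes at least three new vertices when added to S′: otherwise every
-- observed vertex has at most two unobserved neighbours, and then the unobserved vertices linked to
-- a fixed unobserved x (equal to x, adjacent to x, or sharing an observed neighbour with x) form a
-- fort with at most two vertices. Adding such vertices one at a time until S′ becomes a power
-- dominating set, the last unobserved set still being a fort, gives 3γ + f ≤ 3(k + 1) + u. For
-- k ≥ 1 this and β ≥ 1/3 − (f − 3)/(3(f + 3γ − 6)) yield γ ≤ k + βu; for k = 0 nothing is
-- observed, u = n, and β ≥ γ/n suffices.

open import Defs hiding (sym)
open import Data.Bool using (Bool; true; false; T; not; _∧_; _∨_)
open import Data.Bool.Properties using (T-≡; T-∧; T-∨; T?)
open import Data.Bool.ListAction using (any; all)
open import Data.Fin using (Fin; zero; suc; _≟_)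
open import Data.Fin.Properties using (any?; all?; ¬∀⟶∃¬; nonZeroIndex)
open import Data.Fin.Subset hiding (Subset; _-_)
open import Data.Fin.Subset.Properties
open import Data.Integer as ℤ using (+_)
import Data.Integer.Properties as ℤ
open import Data.List using (allFin)
open import Data.List.Membership.Propositional using (lose)
open import Data.List.Membership.Propositional.Properties using (∈-allFin)
import Data.List.Relation.Unary.All as All
open import Data.List.Relation.Unary.All.Properties using (all⁺; all⁻)
open import Data.List.Relation.Unary.Any using (satisfied)
open import Data.List.Relation.Unary.Any.Properties using (any⁺; any⁻)
open import Data.Nat as ℕ using (ℕ; NonZero; zero; suc; z≤n; s≤s)
import Data.Nat.Properties as ℕ
open import Data.Nat.Tactic.RingSolver using (solve-∀)
open import Data.Nat.Induction using (<-rec)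
open import Data.Product using (_×_; _,_; ∃; proj₁; proj₂)
import Data.Product as Product
open import Data.Sum using (_⊎_; inj₁; inj₂; [_,_]′)
import Data.Sum as Sum
open import Data.Vec using (_∷_; []; tabulate; lookup; here)
open import Data.Vec.Properties using (lookup∘tabulate; lookup⇒[]=; []=⇒lookup)
open import Function using (_∘_; id; Equivalence)
open import Relation.Nullary using (¬_; ¬?; Dec; yes; no; does; contradiction)
open import Relation.Nullary.Decidable using (⌊_⌋; _×-dec_; _⊎-dec_; fromWitness; toWitness)
open import Relation.Binary.PropositionalEquality
  using (_≡_; _≢_; refl; sym; trans; subst; cong; cong₂; module ≡-Reasoning)
open Equivalence

module _ where
  open import Data.Rational using (ℚ; _/_; _+_; _*_; _-_; _≤_; 0ℚ; 1ℚ; toℚᵘ)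
  open import Data.Rational.Properties
  open import Data.Rational.Unnormalised as ℚᵘ using (mkℚᵘ; *≡*) renaming (_≃_ to _≃ᵘ_)
  import Data.Rational.Unnormalised.Properties as ℚᵘ
  open import Algebra.Properties.Ring +-*-ring using (x[y-z]≈xy-xz)
  open import Algebra.Properties.AbelianGroup +-0-abelianGroup using (xyx⁻¹≈y)

  toℚᵘ-/1 : ∀ a → toℚᵘ (+ a / 1) ≃ᵘ mkℚᵘ (+ a) 0
  toℚᵘ-/1 a = toℚᵘ-fromℚᵘ (mkℚᵘ (+ a) 0)

  /1-homo-+ : ∀ a b → + (a ℕ.+ b) / 1 ≡ + a / 1 + + b / 1
  /1-homo-+ a b = toℚᵘ-injective (begin
    toℚᵘ (+ (a ℕ.+ b) / 1)               ≈⟨ toℚᵘ-/1 (a ℕ.+ b) ⟩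
    mkℚᵘ (+ (a ℕ.+ b)) 0                 ≈⟨ *≡* eq ⟨
    mkℚᵘ (+ a) 0 ℚᵘ.+ mkℚᵘ (+ b) 0       ≈⟨ ℚᵘ.+-cong (toℚᵘ-/1 a) (toℚᵘ-/1 b) ⟨
    toℚᵘ (+ a / 1) ℚᵘ.+ toℚᵘ (+ b / 1)   ≈⟨ toℚᵘ-homo-+ (+ a / 1) (+ b / 1) ⟨
    toℚᵘ (+ a / 1 + + b / 1)             ∎)
    where
    open ℚᵘ.≃-Reasoning
    eq : (+ a ℤ.* + 1 ℤ.+ + b ℤ.* + 1) ℤ.* + 1 ≡ + (a ℕ.+ b) ℤ.* + 1
    eq = cong (ℤ._* + 1) (trans (cong₂ ℤ._+_ (ℤ.*-identityʳ (+ a)) (ℤ.*-identityʳ (+ b))) (sym (ℤ.pos-+ a b)))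

  /1-homo-* : ∀ a b → + (a ℕ.* b) / 1 ≡ (+ a / 1) * (+ b / 1)
  /1-homo-* a b = toℚᵘ-injective (begin
    toℚᵘ (+ (a ℕ.* b) / 1)               ≈⟨ toℚᵘ-/1 (a ℕ.* b) ⟩
    mkℚᵘ (+ (a ℕ.* b)) 0                 ≈⟨ *≡* (cong (ℤ._* + 1) (sym (ℤ.pos-* a b))) ⟨
    mkℚᵘ (+ a) 0 ℚᵘ.* mkℚᵘ (+ b) 0       ≈⟨ ℚᵘ.*-cong (toℚᵘ-/1 a) (toℚᵘ-/1 b) ⟨
    toℚᵘ (+ a / 1) ℚᵘ.* toℚᵘ (+ b / 1)   ≈⟨ toℚᵘ-homo-* (+ a / 1) (+ b / 1) ⟨
    toℚᵘ ((+ a / 1) * (+ b / 1))         ∎)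
    where open ℚᵘ.≃-Reasoning

  /1-*-frac : ∀ a d .{{_ : NonZero d}} → (+ d / 1) * frac a d ≡ + a / 1
  /1-*-frac a (suc d) = toℚᵘ-injective (begin
    toℚᵘ ((+ suc d / 1) * (+ a / suc d))                      ≈⟨ toℚᵘ-homo-* (+ suc d / 1) (+ a / suc d) ⟩
    toℚᵘ (+ suc d / 1) ℚᵘ.* toℚᵘ (+ a / suc d)               ≈⟨ ℚᵘ.*-cong (toℚᵘ-/1 (suc d)) (toℚᵘ-fromℚᵘ (mkℚᵘ (+ a) d)) ⟩
    mkℚᵘ (+ suc d) 0 ℚᵘ.* mkℚᵘ (+ a) d                        ≈⟨ *≡* eq ⟩
    mkℚᵘ (+ a) 0                                              ≈⟨ toℚᵘ-/1 a ⟨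
    toℚᵘ (+ a / 1)                                            ∎)
    where
    open ℚᵘ.≃-Reasoning
    eq : (+ suc d ℤ.* + a) ℤ.* + 1 ≡ + a ℤ.* + (1 ℕ.* suc d)
    eq = trans (ℤ.*-identityʳ _)
           (trans (ℤ.*-comm (+ suc d) (+ a)) (cong (λ x → + a ℤ.* + x) (sym (ℕ.*-identityˡ (suc d)))))

  /1-nonNeg : ∀ a → 0ℚ ≤ + a / 1
  /1-nonNeg a = nonNegative⁻¹ (+ a / 1) {{normalize-nonNeg a 1}}

  frac-nonNeg : ∀ a d → 0ℚ ≤ frac a d
  frac-nonNeg a zero    = ≤-refl
  frac-nonNeg a (suc d) = nonNegative⁻¹ (+ a / suc d) {{normalize-nonNeg a (suc d)}}

  p≤p+q : ∀ {p q} → 0ℚ ≤ q → p ≤ p + q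
  p≤p+q {p} 0≤q = subst (_≤ p + _) (+-identityʳ p) (+-monoʳ-≤ p 0≤q)

  /1-mono-≤ : ∀ {a b} → a ℕ.≤ b → + a / 1 ≤ + b / 1
  /1-mono-≤ {a} a≤b with ℕ.m≤n⇒∃[o]m+o≡n a≤b
  ... | c , refl = subst (+ a / 1 ≤_) (sym (/1-homo-+ a c)) (p≤p+q (/1-nonNeg c))

  dp≡c∧md≤cu⇒m≤pu : ∀ d .{{_ : NonZero d}} {m c u p} → (+ d / 1) * p ≡ + c / 1 →
                     m ℕ.* d ℕ.≤ c ℕ.* u → + m / 1 ≤ p * (+ u / 1)
  dp≡c∧md≤cu⇒m≤pu d {m} {c} {u} {p} dp≡c md≤cu = *-cancelˡ-≤-pos (+ d / 1) {{normalize-pos d 1}} (begin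
    (+ d / 1) * (+ m / 1)      ≡⟨ /1-homo-* d m ⟨
    + (d ℕ.* m) / 1            ≤⟨ /1-mono-≤ (subst (ℕ._≤ c ℕ.* u) (ℕ.*-comm m d) md≤cu) ⟩
    + (c ℕ.* u) / 1            ≡⟨ /1-homo-* c u ⟩
    (+ c / 1) * (+ u / 1)      ≡⟨ cong (_* (+ u / 1)) dp≡c ⟨
    (+ d / 1) * p * (+ u / 1)  ≡⟨ *-assoc (+ d / 1) p (+ u / 1) ⟩
    (+ d / 1) * (p * (+ u / 1)) ∎)
    where open ≤-Reasoning

  threshold : ℕ → ℕ → ℚ
  threshold f γ = frac 1 3 - frac (f ℕ.∸ 3) (3 ℕ.* ((f ℕ.+ 3 ℕ.* γ) ℕ.∸ 6))

  3[e+c]*[1/3-e/3[e+c]]≡c : ∀ e c .{{_ : NonZero (e ℕ.+ c)}} →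
                    (+ (3 ℕ.* (e ℕ.+ c)) / 1) * (frac 1 3 - frac e (3 ℕ.* (e ℕ.+ c))) ≡ + c / 1
  3[e+c]*[1/3-e/3[e+c]]≡c e c = begin
    ι (3 ℕ.* d) * (frac 1 3 - frac e (3 ℕ.* d))            ≡⟨ x[y-z]≈xy-xz (ι (3 ℕ.* d)) (frac 1 3) (frac e (3 ℕ.* d)) ⟩
    ι (3 ℕ.* d) * frac 1 3 - ι (3 ℕ.* d) * frac e (3 ℕ.* d) ≡⟨ cong₂ _-_ 3d*⅓≡d (/1-*-frac e (3 ℕ.* d) {{ℕ.m*n≢0 3 d}}) ⟩
    ι d - ι e                                               ≡⟨ cong (_- ι e) (/1-homo-+ e c) ⟩
    ι e + ι c - ι e                                         ≡⟨ xyx⁻¹≈y (ι e) (ι c) ⟩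
    ι c                                                     ∎
    where
    open ≡-Reasoning
    ι : ℕ → ℚ
    ι a = + a / 1
    d = e ℕ.+ c
    3d*⅓≡d : ι (3 ℕ.* d) * frac 1 3 ≡ ι d
    3d*⅓≡d = begin
      ι (3 ℕ.* d) * frac 1 3   ≡⟨ cong (_* frac 1 3) (trans (/1-homo-* 3 d) (*-comm (ι 3) (ι d))) ⟩
      ι d * ι 3 * frac 1 3     ≡⟨ *-assoc (ι d) (ι 3) (frac 1 3) ⟩
      ι d * (ι 3 * frac 1 3)   ≡⟨ cong (ι d *_) (/1-*-frac 1 3) ⟩
      ι d * 1ℚ                 ≡⟨ *-identityʳ (ι d) ⟩
      ι d                      ∎

  a≤k⇒a≤k+βu : ∀ {a k u β} → a ℕ.≤ k → 0ℚ ≤ β → + a / 1 ≤ + k / 1 + β * (+ u / 1)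
  a≤k⇒a≤k+βu {u = u} {β} a≤k 0≤β = ≤-trans (/1-mono-≤ a≤k) (p≤p+q 0≤βu)
    where
    0≤βu : 0ℚ ≤ β * (+ u / 1)
    0≤βu = subst (_≤ β * (+ u / 1)) (*-zeroˡ (+ u / 1)) (*-monoʳ-≤-nonNeg (+ u / 1) {{normalize-nonNeg u 1}} 0≤β)

  a/u≤β⇒a≤0+βu : ∀ {a u β} .{{_ : NonZero u}} → frac a u ≤ β → + a / 1 ≤ + 0 / 1 + β * (+ u / 1)
  a/u≤β⇒a≤0+βu {a} {u} {β} a/u≤β = begin
    + a / 1                         ≡⟨ /1-*-frac a u ⟨
    (+ u / 1) * frac a u            ≡⟨ *-comm (+ u / 1) (frac a u) ⟩
    frac a u * (+ u / 1)            ≤⟨ *-monoʳ-≤-nonNeg (+ u / 1) {{normalize-nonNeg u 1}} a/u≤β ⟩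
    β * (+ u / 1)                   ≡⟨ +-identityˡ (β * (+ u / 1)) ⟨
    + 0 / 1 + β * (+ u / 1)         ∎
    where open ≤-Reasoning

  m[3[e+3c]]≤3cu : ∀ {m e c u} → m ℕ.≤ c → 3 ℕ.* m ℕ.+ e ℕ.≤ u → m ℕ.* (3 ℕ.* (e ℕ.+ 3 ℕ.* c)) ℕ.≤ 3 ℕ.* c ℕ.* u
  m[3[e+3c]]≤3cu {m} {e} {c} {u} m≤c 3m+e≤u = begin
    m ℕ.* (3 ℕ.* (e ℕ.+ 3 ℕ.* c))        ≡⟨ expand m e c ⟩
    3 ℕ.* (e ℕ.* m ℕ.+ c ℕ.* (3 ℕ.* m))  ≤⟨ ℕ.*-monoʳ-≤ 3 (ℕ.+-monoˡ-≤ (c ℕ.* (3 ℕ.* m)) (ℕ.*-monoʳ-≤ e m≤c)) ⟩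
    3 ℕ.* (e ℕ.* c ℕ.+ c ℕ.* (3 ℕ.* m))  ≡⟨ regroup m e c ⟩
    3 ℕ.* c ℕ.* (3 ℕ.* m ℕ.+ e)          ≤⟨ ℕ.*-monoʳ-≤ (3 ℕ.* c) 3m+e≤u ⟩
    3 ℕ.* c ℕ.* u                        ∎
    where
    open ℕ.≤-Reasoning
    expand : ∀ m e c → m ℕ.* (3 ℕ.* (e ℕ.+ 3 ℕ.* c)) ≡ 3 ℕ.* (e ℕ.* m ℕ.+ c ℕ.* (3 ℕ.* m))
    expand = solve-∀
    regroup : ∀ m e c → 3 ℕ.* (e ℕ.* c ℕ.+ c ℕ.* (3 ℕ.* m)) ≡ 3 ℕ.* c ℕ.* (3 ℕ.* m ℕ.+ e)
    regroup = solve-∀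

  3[1+s′]+u′≤3[1+s]+u : ∀ {s s′ u u′} → s′ ℕ.≤ suc s → 3 ℕ.+ u′ ℕ.≤ u →
                         3 ℕ.* suc s′ ℕ.+ u′ ℕ.≤ 3 ℕ.* suc s ℕ.+ u
  3[1+s′]+u′≤3[1+s]+u {s} {s′} {u} {u′} s′≤1+s 3+u′≤u = begin
    3 ℕ.* suc s′ ℕ.+ u′          ≤⟨ ℕ.+-monoˡ-≤ u′ (ℕ.*-monoʳ-≤ 3 (s≤s s′≤1+s)) ⟩
    3 ℕ.* suc (suc s) ℕ.+ u′     ≡⟨ regroup s u′ ⟩
    3 ℕ.* suc s ℕ.+ (3 ℕ.+ u′)   ≤⟨ ℕ.+-monoʳ-≤ (3 ℕ.* suc s) 3+u′≤u ⟩
    3 ℕ.* suc s ℕ.+ u            ∎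
    where
    open ℕ.≤-Reasoning
    regroup : ∀ s u′ → 3 ℕ.* suc (suc s) ℕ.+ u′ ≡ 3 ℕ.* suc s ℕ.+ (3 ℕ.+ u′)
    regroup = solve-∀

  -- With f = 3 + e and γ = c + 2, the threshold is 1/3 − e/(3d) for d = e + 3(c + 1), and 3d times
  -- it is 3(c + 1).
  m≤threshold*u : ∀ e c m u → m ℕ.≤ suc c → 3 ℕ.* m ℕ.+ e ℕ.≤ u →
                  + m / 1 ≤ threshold (3 ℕ.+ e) (suc (suc c)) * (+ u / 1)
  m≤threshold*u e c m u m≤c 3m+e≤u =
    dp≡c∧md≤cu⇒m≤pu (3 ℕ.* d) {{ℕ.m*n≢0 3 d}} {m} {3 ℕ.* suc c} {u} scaled (m[3[e+3c]]≤3cu m≤c 3m+e≤u)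
    where
    d = e ℕ.+ 3 ℕ.* suc c
    instance
      d≢0 : NonZero d
      d≢0 = ℕ.>-nonZero (ℕ.<-≤-trans ℕ.z<s (ℕ.m≤n+m (3 ℕ.* suc c) e))
    denominator : (e ℕ.+ 3 ℕ.* suc (suc c)) ℕ.∸ 3 ≡ d
    denominator = trans (cong (ℕ._∸ 3) (e+3[1+c]≡3+e+3c e (suc c))) (ℕ.m+n∸m≡n 3 d)
      where
      e+3[1+c]≡3+e+3c : ∀ e c → e ℕ.+ 3 ℕ.* suc c ≡ 3 ℕ.+ (e ℕ.+ 3 ℕ.* c)
      e+3[1+c]≡3+e+3c = solve-∀
    scaled : (+ (3 ℕ.* d) / 1) * threshold (3 ℕ.+ e) (suc (suc c)) ≡ + (3 ℕ.* suc c) / 1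
    scaled = trans (cong (λ x → (+ (3 ℕ.* d) / 1) * (frac 1 3 - frac e (3 ℕ.* x))) denominator)
                   (3[e+c]*[1/3-e/3[e+c]]≡c e (3 ℕ.* suc c))

  threshold≤β⇒γ≤k+βu : ∀ {f γ k u β} → 3 ℕ.≤ f → 0 ℕ.< k → 3 ℕ.* γ ℕ.+ f ℕ.≤ 3 ℕ.* suc k ℕ.+ u →
                        0ℚ ≤ β → threshold f γ ≤ β → + γ / 1 ≤ + k / 1 + β * (+ u / 1)
  threshold≤β⇒γ≤k+βu {suc (suc (suc e))} {γ} {suc k′} {u} {β} (s≤s (s≤s (s≤s _))) (s≤s _) count 0≤β t≤β
    with γ ℕ.≤? suc k′
  ... | yes γ≤k = a≤k⇒a≤k+βu {u = u} γ≤k 0≤β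
  ... | no  γ≰k with ℕ.m≤n⇒∃[o]m+o≡n (ℕ.≰⇒> γ≰k)
  ...   | o , refl = begin
    + (suc k ℕ.+ o) / 1            ≡⟨ cong (λ x → + x / 1) (ℕ.+-suc k o) ⟨
    + (k ℕ.+ suc o) / 1            ≡⟨ /1-homo-+ k (suc o) ⟩
    + k / 1 + + suc o / 1          ≤⟨ +-monoʳ-≤ (+ k / 1) m≤βu ⟩
    + k / 1 + β * (+ u / 1)        ∎
    where
    open ≤-Reasoning
    k = suc k′
    3m+e≤u : 3 ℕ.* suc o ℕ.+ e ℕ.≤ u
    3m+e≤u = ℕ.+-cancelˡ-≤ (3 ℕ.* suc k) _ _ (subst (ℕ._≤ 3 ℕ.* suc k ℕ.+ u) (regroup k o e) count)
      where
      regroup : ∀ k o e → 3 ℕ.* (suc k ℕ.+ o) ℕ.+ (3 ℕ.+ e) ≡ 3 ℕ.* suc k ℕ.+ (3 ℕ.* suc o ℕ.+ e)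
      regroup = solve-∀
    m≤βu : + suc o / 1 ≤ β * (+ u / 1)
    m≤βu = begin
      + suc o / 1                                         ≤⟨ m≤threshold*u e (k′ ℕ.+ o) (suc o) u (s≤s (ℕ.m≤n+m o k′)) 3m+e≤u ⟩
      threshold (3 ℕ.+ e) (suc k ℕ.+ o) * (+ u / 1)      ≤⟨ *-monoʳ-≤-nonNeg (+ u / 1) {{normalize-nonNeg u 1}} t≤β ⟩
      β * (+ u / 1)                                       ∎

open import Data.Nat using (ℕ; _≤_; _<_; _+_; _*_; _∸_)
open import Data.Fin.Subset using (Subset)
open import Data.Rational using (ℚ; _-_; _⊔_; _/_; 0ℚ)
import Data.Rational as Q
import Data.Rational.Properties as ℚ

private variable
  n : ℕ
  p q : Subset n
  x y z : Fin n

∈⇒T-lookup : x ∈ p → T (lookup p x)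
∈⇒T-lookup x∈p = from T-≡ ([]=⇒lookup x∈p)

T-lookup⇒∈ : T (lookup p x) → x ∈ p
T-lookup⇒∈ {p = p} {x} t = lookup⇒[]= x p (to T-≡ t)

∉⇒T-not-lookup : x ∉ p → T (not (lookup p x))
∉⇒T-not-lookup {x = x} {p} x∉p with lookup p x in eq
... | true  = x∉p (lookup⇒[]= x p eq)
... | false = _

∈-tabulate⁺ : ∀ {f : Fin n → Bool} → T (f x) → x ∈ tabulate f
∈-tabulate⁺ {x = x} {f} fx = lookup⇒[]= x _ (trans (lookup∘tabulate f x) (to T-≡ fx))

∈-tabulate⁻ : ∀ {f : Fin n → Bool} → x ∈ tabulate f → T (f x)
∈-tabulate⁻ {x = x} {f} x∈ = from T-≡ (trans (sym (lookup∘tabulate f x)) ([]=⇒lookup x∈))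

T-any-allFin⁺ : ∀ {f : Fin n → Bool} x → T (f x) → T (any f (allFin n))
T-any-allFin⁺ {n} {f} x fx = any⁺ f (lose (∈-allFin x) fx)

T-any-allFin⁻ : ∀ {f : Fin n → Bool} → T (any f (allFin n)) → ∃ (T ∘ f)
T-any-allFin⁻ {n} {f} t = satisfied (any⁻ f (allFin n) t)

T-all-allFin⁺ : ∀ {f : Fin n → Bool} → (∀ x → T (f x)) → T (all f (allFin n))
T-all-allFin⁺ {n} {f} h = all⁻ f {allFin n} (All.tabulate (λ {x} _ → h x))

T-all-allFin⁻ : ∀ {f : Fin n → Bool} → T (all f (allFin n)) → ∀ x → T (f x)
T-all-allFin⁻ {n} {f} t x = All.lookup (all⁺ f (allFin n) t) (∈-allFin x)

x∈p⇒0<∣p∣ : x ∈ p → 0 < ∣ p ∣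
x∈p⇒0<∣p∣ {x = x} {p} x∈p = subst (_≤ ∣ p ∣) (∣⁅x⁆∣≡1 x) (p⊆q⇒∣p∣≤∣q∣ ⁅x⁆⊆p)
  where
  ⁅x⁆⊆p : ⁅ x ⁆ ⊆ p
  ⁅x⁆⊆p y∈⁅x⁆ = subst (_∈ p) (sym (x∈⁅y⁆⇒x≡y x y∈⁅x⁆)) x∈p

0<∣p∣⇒Nonempty : 0 < ∣ p ∣ → Nonempty p
0<∣p∣⇒Nonempty {n} {p} 0<∣p∣ with nonempty? p
... | yes ne = ne
... | no ¬ne = contradiction (trans (cong ∣_∣ (Empty-unique ¬ne)) (∣⊥∣≡0 n)) (ℕ.<⇒≢ 0<∣p∣ ∘ sym)

∣p∣≡0⇒p≡⊥ : ∣ p ∣ ≡ 0 → p ≡ ⊥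
∣p∣≡0⇒p≡⊥ ∣p∣≡0 = Empty-unique (λ (x , x∈p) → ℕ.<⇒≢ (x∈p⇒0<∣p∣ x∈p) (sym ∣p∣≡0))

x∈p∧y∈p∧y≢x⇒2≤∣p∣ : x ∈ p → y ∈ p → y ≢ x → 2 ≤ ∣ p ∣
x∈p∧y∈p∧y≢x⇒2≤∣p∣ x∈p y∈p y≢x =
  ℕ.≤-trans (s≤s (x∈p⇒0<∣p∣ (x∈p∧x≢y⇒x∈p-y y∈p y≢x))) (x∈p⇒∣p-x∣<∣p∣ x∈p)

∣p∣≤1⇒x≡y : ∣ p ∣ ≤ 1 → x ∈ p → y ∈ p → x ≡ y
∣p∣≤1⇒x≡y {x = x} {y = y} ∣p∣≤1 x∈p y∈p with x ≟ y
... | yes x≡y = x≡y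
... | no  x≢y with ℕ.≤-trans (x∈p∧y∈p∧y≢x⇒2≤∣p∣ y∈p x∈p x≢y) ∣p∣≤1
...   | s≤s ()

∣p∣≤2⇒z≡x⊎z≡y : ∣ p ∣ ≤ 2 → x ∈ p → y ∈ p → y ≢ x → z ∈ p → z ≡ x ⊎ z ≡ y
∣p∣≤2⇒z≡x⊎z≡y {x = x} {z = z} ∣p∣≤2 x∈p y∈p y≢x z∈p with z ≟ x
... | yes z≡x = inj₁ z≡x
... | no  z≢x = inj₂ (∣p∣≤1⇒x≡y ∣p-x∣≤1 (x∈p∧x≢y⇒x∈p-y z∈p z≢x) (x∈p∧x≢y⇒x∈p-y y∈p y≢x))
  where
  ∣p-x∣≤1 = ℕ.≤-pred (ℕ.≤-trans (x∈p⇒∣p-x∣<∣p∣ x∈p) ∣p∣≤2)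

2≤∣p∣⇒∃≢ : 2 ≤ ∣ p ∣ → x ∈ p → ∃ λ y → y ∈ p × y ≢ x
2≤∣p∣⇒∃≢ {p = p} {x = x} 2≤∣p∣ x∈p with any? (λ y → y ∈? p ×-dec ¬? (y ≟ x))
... | yes found = found
... | no  none with ℕ.≤-trans 2≤∣p∣ (subst (∣ p ∣ ≤_) (∣⁅x⁆∣≡1 x) (p⊆q⇒∣p∣≤∣q∣ p⊆⁅x⁆))
  where
  p⊆⁅x⁆ : p ⊆ ⁅ x ⁆
  p⊆⁅x⁆ {y} y∈p with y ≟ x
  ... | yes refl = x∈⁅x⁆ x
  ... | no  y≢x  = contradiction (y , y∈p , y≢x) none
...   | s≤s ()

∣p∪q∣≤∣p∣+∣q∣ : ∀ (p q : Subset n) → ∣ p ∪ q ∣ ≤ ∣ p ∣ + ∣ q ∣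
∣p∪q∣≤∣p∣+∣q∣ []            []            = z≤n
∣p∪q∣≤∣p∣+∣q∣ (inside  ∷ p) (inside  ∷ q) = s≤s (ℕ.≤-trans (∣p∪q∣≤∣p∣+∣q∣ p q) (ℕ.+-monoʳ-≤ ∣ p ∣ (ℕ.n≤1+n ∣ q ∣)))
∣p∪q∣≤∣p∣+∣q∣ (inside  ∷ p) (outside ∷ q) = s≤s (∣p∪q∣≤∣p∣+∣q∣ p q)
∣p∪q∣≤∣p∣+∣q∣ (outside ∷ p) (inside  ∷ q) =
  subst (suc ∣ p ∪ q ∣ ≤_) (sym (ℕ.+-suc ∣ p ∣ ∣ q ∣)) (s≤s (∣p∪q∣≤∣p∣+∣q∣ p q))
∣p∪q∣≤∣p∣+∣q∣ (outside ∷ p) (outside ∷ q) = ∣p∪q∣≤∣p∣+∣q∣ p q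

∣p∪⁅x⁆∣≤1+∣p∣ : ∀ (p : Subset n) x → ∣ p ∪ ⁅ x ⁆ ∣ ≤ suc ∣ p ∣
∣p∪⁅x⁆∣≤1+∣p∣ p x =
  subst (∣ p ∪ ⁅ x ⁆ ∣ ≤_) (trans (cong (_+_ ∣ p ∣) (∣⁅x⁆∣≡1 x)) (ℕ.+-comm ∣ p ∣ 1)) (∣p∪q∣≤∣p∣+∣q∣ p ⁅ x ⁆)

∣∁q∣+∣q─p∣≡∣∁p∣ : p ⊆ q → ∣ ∁ q ∣ + ∣ q ─ p ∣ ≡ ∣ ∁ p ∣
∣∁q∣+∣q─p∣≡∣∁p∣ {p = []}          {[]}          p⊆q = refl
∣∁q∣+∣q─p∣≡∣∁p∣ {p = inside  ∷ p} {inside  ∷ q} p⊆q = ∣∁q∣+∣q─p∣≡∣∁p∣ (drop-∷-⊆ p⊆q)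
∣∁q∣+∣q─p∣≡∣∁p∣ {p = inside  ∷ p} {outside ∷ q} p⊆q with () ← p⊆q here
∣∁q∣+∣q─p∣≡∣∁p∣ {p = outside ∷ p} {inside  ∷ q} p⊆q =
  trans (ℕ.+-suc ∣ ∁ q ∣ ∣ q ─ p ∣) (cong suc (∣∁q∣+∣q─p∣≡∣∁p∣ (drop-∷-⊆ p⊆q)))
∣∁q∣+∣q─p∣≡∣∁p∣ {p = outside ∷ p} {outside ∷ q} p⊆q = cong suc (∣∁q∣+∣q─p∣≡∣∁p∣ (drop-∷-⊆ p⊆q))

module _ {n : ℕ} (G : Graph n) where

  Adj : Fin n → Fin n → Set
  Adj u v = T (adj G u v)

  Adj-sym : ∀ {u v} → Adj u v → Adj v u
  Adj-sym {u} {v} = subst T (Graph.sym G u v)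

  Adj-irrefl : ∀ {v} → ¬ Adj v v
  Adj-irrefl {v} = subst T (Graph.irrefl G v)

  -- Unlike forces, Forces does not require v ∉ O; this makes it monotone in O.
  Forces : Subset n → Fin n → Fin n → Set
  Forces O u v = u ∈ O × Adj u v × (∀ {w} → Adj u w → w ≢ v → w ∈ O)

  ForcingClosed : Subset n → Set
  ForcingClosed O = ∀ {u v} → Forces O u v → v ∈ O

  ∈-closedNbhd⁺ : ∀ {S v} → v ∈ S ⊎ (∃ λ u → u ∈ S × Adj u v) → v ∈ closedNbhd G S
  ∈-closedNbhd⁺ (inj₁ v∈S)             = ∈-tabulate⁺ (from T-∨ (inj₁ (∈⇒T-lookup v∈S)))
  ∈-closedNbhd⁺ (inj₂ (u , u∈S , u~v)) =
    ∈-tabulate⁺ (from T-∨ (inj₂ (T-any-allFin⁺ u (from T-∧ (∈⇒T-lookup u∈S , u~v)))))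

  ∈-closedNbhd⁻ : ∀ {S v} → v ∈ closedNbhd G S → v ∈ S ⊎ (∃ λ u → u ∈ S × Adj u v)
  ∈-closedNbhd⁻ v∈ = Sum.map T-lookup⇒∈ (Product.map₂ (Product.map₁ T-lookup⇒∈ ∘ to T-∧) ∘ T-any-allFin⁻)
                             (to T-∨ (∈-tabulate⁻ v∈))

  closedNbhd-mono : ∀ {S S′} → S ⊆ S′ → closedNbhd G S ⊆ closedNbhd G S′
  closedNbhd-mono S⊆S′ = ∈-closedNbhd⁺ ∘ Sum.map S⊆S′ (Product.map₂ (Product.map₁ S⊆S′)) ∘ ∈-closedNbhd⁻

  private
    excused : Subset n → Fin n → Fin n → Fin n → Bool
    excused O u v w = not (adj G u w) ∨ does (w ≟ v) ∨ mem G O w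

    T-excused⁺ : ∀ {O u v w} → (Adj u w → w ≢ v → w ∈ O) → T (excused O u v w)
    T-excused⁺ {u = u} {v} {w} h with adj G u w | w ≟ v
    ... | false | _       = _
    ... | true  | yes _   = _
    ... | true  | no  w≢v = ∈⇒T-lookup (h _ w≢v)

    T-excused⁻ : ∀ {O u v w} → T (excused O u v w) → Adj u w → w ≢ v → w ∈ O
    T-excused⁻ {u = u} {v} {w} t u~w w≢v with adj G u w | w ≟ v
    ... | true | yes w≡v = contradiction w≡v w≢v
    ... | true | no  _   = T-lookup⇒∈ t

  T-forces⁺ : ∀ {O u v} → Forces O u v → v ∉ O → T (forces G O u v)
  T-forces⁺ {O} {u} {v} (u∈O , u~v , others) v∉O = from T-∧ (∈⇒T-lookup u∈O , from T-∧ (u~v ,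
    from T-∧ (∉⇒T-not-lookup v∉O , T-all-allFin⁺ {f = excused O u v} (λ _ → T-excused⁺ others))))

  T-forces⁻ : ∀ {O u v} → T (forces G O u v) → Forces O u v
  T-forces⁻ {O} {u} {v} t with to T-∧ t
  ... | u∈O , t₁ with to T-∧ t₁
  ...   | u~v , t₂ = T-lookup⇒∈ u∈O , u~v , T-excused⁻ (T-all-allFin⁻ {f = excused O u v} (proj₂ (to T-∧ t₂)) _)

  ∈-step⁺ : ∀ {O v} → v ∈ O ⊎ (∃ λ u → Forces O u v) → v ∈ step G O
  ∈-step⁺ (inj₁ v∈O) = ∈-tabulate⁺ (from T-∨ (inj₁ (∈⇒T-lookup v∈O)))
  ∈-step⁺ {O} {v} (inj₂ (u , u→v)) with v ∈? O
  ... | yes v∈O = ∈-step⁺ (inj₁ v∈O)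
  ... | no  v∉O = ∈-tabulate⁺ (from T-∨ (inj₂ (T-any-allFin⁺ u (T-forces⁺ u→v v∉O))))

  ∈-step⁻ : ∀ {O v} → v ∈ step G O → v ∈ O ⊎ (∃ λ u → Forces O u v)
  ∈-step⁻ v∈ = Sum.map T-lookup⇒∈ (Product.map₂ T-forces⁻ ∘ T-any-allFin⁻) (to T-∨ (∈-tabulate⁻ v∈))

  Forces-mono : ∀ {O O′ u v} → O ⊆ O′ → Forces O u v → Forces O′ u v
  Forces-mono O⊆O′ (u∈O , u~v , others) = O⊆O′ u∈O , u~v , λ u~w w≢v → O⊆O′ (others u~w w≢v)

  ⊆-step : ∀ {O} → O ⊆ step G O
  ⊆-step = ∈-step⁺ ∘ inj₁

  step-mono : ∀ {O O′} → O ⊆ O′ → step G O ⊆ step G O′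
  step-mono O⊆O′ = ∈-step⁺ ∘ Sum.map O⊆O′ (Product.map₂ (Forces-mono O⊆O′)) ∘ ∈-step⁻

  ⊆-iter : ∀ k {O} → O ⊆ iter G k O
  ⊆-iter zero    = id
  ⊆-iter (suc k) = ⊆-iter k ∘ ⊆-step

  iter-mono : ∀ k {O O′} → O ⊆ O′ → iter G k O ⊆ iter G k O′
  iter-mono zero    O⊆O′ = O⊆O′
  iter-mono (suc k) O⊆O′ = iter-mono k (step-mono O⊆O′)

  iter-fixed : ∀ k {O} → ForcingClosed O → iter G k O ≡ O
  iter-fixed zero    closed = refl
  iter-fixed (suc k) closed = trans (cong (iter G k) step≡) (iter-fixed k closed)
    where
    step≡ = ⊆-antisym ([ id , closed ∘ proj₂ ]′ ∘ ∈-step⁻) ⊆-step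

  iter-closed-or-grows : ∀ k O → ForcingClosed (iter G k O) ⊎ k + ∣ O ∣ ≤ ∣ iter G k O ∣
  iter-closed-or-grows zero    O = inj₂ ℕ.≤-refl
  iter-closed-or-grows (suc k) O with any? (λ v → v ∈? step G O ×-dec ¬? (v ∈? O))
  ... | no  none = inj₁ (subst ForcingClosed (sym (iter-fixed (suc k) closed)) closed)
    where
    closed : ForcingClosed O
    closed {u} {v} u→v with v ∈? O
    ... | yes v∈O = v∈O
    ... | no  v∉O = contradiction (v , ∈-step⁺ (inj₂ (u , u→v)) , v∉O) none
  ... | yes (v , v∈step , v∉O) = Sum.map₂ grow (iter-closed-or-grows k (step G O))
    where
    grow : k + ∣ step G O ∣ ≤ ∣ iter G k (step G O) ∣ → suc k + ∣ O ∣ ≤ ∣ iter G k (step G O) ∣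
    grow = ℕ.≤-trans (subst (_≤ k + ∣ step G O ∣) (ℕ.+-suc k ∣ O ∣)
                       (ℕ.+-monoʳ-≤ k (p⊂q⇒∣p∣<∣q∣ (⊆-step , v , v∈step , v∉O))))

  Obs-forcingClosed : ∀ S → ForcingClosed (Obs G S)
  Obs-forcingClosed S with iter-closed-or-grows n (closedNbhd G S)
  ... | inj₁ closed = closed
  ... | inj₂ grown  = λ _ → subst (_ ∈_) (sym Obs≡⊤) ∈⊤
    where
    Obs≡⊤ = ∣p∣≡n⇒p≡⊤ (ℕ.≤-antisym (∣p∣≤n (Obs G S)) (ℕ.≤-trans (ℕ.m≤m+n n _) grown))

  ∈⇒∈Obs : ∀ {S v} → v ∈ S → v ∈ Obs G S
  ∈⇒∈Obs = ⊆-iter n ∘ ∈-closedNbhd⁺ ∘ inj₁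

  Adj⇒∈Obs : ∀ {S u v} → u ∈ S → Adj u v → v ∈ Obs G S
  Adj⇒∈Obs u∈S u~v = ⊆-iter n (∈-closedNbhd⁺ (inj₂ (_ , u∈S , u~v)))

  Obs-mono : ∀ {S S′} → S ⊆ S′ → Obs G S ⊆ Obs G S′
  Obs-mono S⊆S′ = iter-mono n (closedNbhd-mono S⊆S′)

  Obs⊆Obs∪⁅z⁆ : ∀ S z → Obs G S ⊆ Obs G (S ∪ ⁅ z ⁆)
  Obs⊆Obs∪⁅z⁆ S z = Obs-mono (p⊆p∪q {p = S} ⁅ z ⁆)

  z∈Obs∪⁅z⁆ : ∀ S z → z ∈ Obs G (S ∪ ⁅ z ⁆)
  z∈Obs∪⁅z⁆ S z = ∈⇒∈Obs (q⊆p∪q S ⁅ z ⁆ (x∈⁅x⁆ z))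

  Adj⇒∈Obs∪⁅z⁆ : ∀ S {z v} → Adj z v → v ∈ Obs G (S ∪ ⁅ z ⁆)
  Adj⇒∈Obs∪⁅z⁆ S {z} = Adj⇒∈Obs (q⊆p∪q S ⁅ z ⁆ (x∈⁅x⁆ z))

  isPDS? : ∀ S → Dec (IsPDS G S)
  isPDS? S = all? (λ v → v ∈? Obs G S)

  ¬IsPDS⇒∃∉Obs : ∀ S → ¬ IsPDS G S → ∃ λ v → v ∉ Obs G S
  ¬IsPDS⇒∃∉Obs S = ¬∀⟶∃¬ n _ (λ v → v ∈? Obs G S)

  Obs-⊥ : Obs G ⊥ ≡ ⊥
  Obs-⊥ = trans (cong (iter G n) closedNbhd-⊥) (iter-fixed n (λ (u∈⊥ , _) → contradiction u∈⊥ ∉⊥))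
    where
    closedNbhd-⊥ : closedNbhd G ⊥ ≡ ⊥
    closedNbhd-⊥ = ⊆-antisym ([ id , (λ (_ , u∈⊥ , _) → contradiction u∈⊥ ∉⊥) ]′ ∘ ∈-closedNbhd⁻) ⊥⊆

  IsPDS⇒Obs≡⊤ : ∀ {S} → IsPDS G S → Obs G S ≡ ⊤
  IsPDS⇒Obs≡⊤ pds = ⊆-antisym ⊆⊤ (λ {v} _ → pds v)

  neighboursIn : Subset n → Fin n → Subset n
  neighboursIn F v = tabulate (λ u → adj G v u ∧ mem G F u)

  ∈-neighboursIn⁺ : ∀ {F v u} → Adj v u → u ∈ F → u ∈ neighboursIn F v
  ∈-neighboursIn⁺ v~u u∈F = ∈-tabulate⁺ (from T-∧ (v~u , ∈⇒T-lookup u∈F))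

  ∈-neighboursIn⁻ : ∀ {F v u} → u ∈ neighboursIn F v → Adj v u × u ∈ F
  ∈-neighboursIn⁻ = Product.map₂ T-lookup⇒∈ ∘ to T-∧ ∘ ∈-tabulate⁻

  ∁Obs-isFort : ∀ {S v} → v ∉ Obs G S → IsFort G (∁ (Obs G S))
  ∁Obs-isFort {S} {v} v∉O = (v , x∉p⇒x∈∁p v∉O) , no-single-neighbour
    where
    O = Obs G S
    no-single-neighbour : ∀ w → w ∉ ∁ O → nbrsIn G (∁ O) w ≢ 1
    no-single-neighbour w w∉U one with 0<∣p∣⇒Nonempty (ℕ.≤-reflexive (sym one))
    ... | t , t∈N = x∈∁p⇒x∉p t∈U (Obs-forcingClosed S (x∉∁p⇒x∈p w∉U , w~t , others))
      where
      w~t = proj₁ (∈-neighboursIn⁻ {∁ O} {w} t∈N)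
      t∈U = proj₂ (∈-neighboursIn⁻ {∁ O} {w} t∈N)
      others : ∀ {w′} → Adj w w′ → w′ ≢ t → w′ ∈ O
      others w~w′ w′≢t = x∉∁p⇒x∈p (λ w′∈U → w′≢t (∣p∣≤1⇒x≡y (ℕ.≤-reflexive one) (∈-neighboursIn⁺ w~w′ w′∈U) t∈N))

  newlyObserved : Subset n → Fin n → Subset n
  newlyObserved S z = Obs G (S ∪ ⁅ z ⁆) ─ Obs G S

  ∣∁Obs∪⁅z⁆∣+∣newlyObserved∣≡∣∁Obs∣ : ∀ S z → ∣ ∁ (Obs G (S ∪ ⁅ z ⁆)) ∣ + ∣ newlyObserved S z ∣ ≡ ∣ ∁ (Obs G S) ∣
  ∣∁Obs∪⁅z⁆∣+∣newlyObserved∣≡∣∁Obs∣ S z = ∣∁q∣+∣q─p∣≡∣∁p∣ (Obs⊆Obs∪⁅z⁆ S z)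

  module _ (S : Subset n) where
    private
      O = Obs G S
      U = ∁ O

    Linked : Fin n → Fin n → Set
    Linked x y = x ≡ y ⊎ Adj x y ⊎ ∃ λ w → w ∈ O × Adj w x × Adj w y

    Linked-sym : ∀ {x y} → Linked x y → Linked y x
    Linked-sym (inj₁ refl)                            = inj₁ refl
    Linked-sym (inj₂ (inj₁ x~y))                      = inj₂ (inj₁ (Adj-sym x~y))
    Linked-sym (inj₂ (inj₂ (w , w∈O , w~x , w~y))) = inj₂ (inj₂ (w , w∈O , w~y , w~x))

    linked? : ∀ x y → Dec (Linked x y)
    linked? x y = x ≟ y ⊎-dec T? (adj G x y) ⊎-dec any? (λ w → w ∈? O ×-dec T? (adj G w x) ×-dec T? (adj G w y))

    reach : Fin n → Subset n
    reach x = tabulate (λ y → ⌊ y ∈? U ×-dec linked? x y ⌋)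

    ∈-reach⁺ : ∀ {x y} → y ∈ U → Linked x y → y ∈ reach x
    ∈-reach⁺ {x} {y} y∈U xy = ∈-tabulate⁺ (fromWitness {a? = y ∈? U ×-dec linked? x y} (y∈U , xy))

    ∈-reach⁻ : ∀ {x y} → y ∈ reach x → y ∈ U × Linked x y
    ∈-reach⁻ {x} {y} = toWitness {a? = y ∈? U ×-dec linked? x y} ∘ ∈-tabulate⁻

    module _ (small-gains : ∀ z → ∣ newlyObserved S z ∣ ≤ 2) where

      ∣neighboursIn∣≤2 : ∀ w → ∣ neighboursIn U w ∣ ≤ 2
      ∣neighboursIn∣≤2 w = ℕ.≤-trans (p⊆q⇒∣p∣≤∣q∣ N⊆new) (small-gains w)
        where
        N⊆new : neighboursIn U w ⊆ newlyObserved S w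
        N⊆new t∈N with ∈-neighboursIn⁻ t∈N
        ... | w~t , t∈U = x∈p∧x∉q⇒x∈p─q (Adj⇒∈Obs∪⁅z⁆ S w~t) (x∈∁p⇒x∉p t∈U)

      ∣reach∣≤2 : ∀ {x} → x ∈ U → ∣ reach x ∣ ≤ 2
      ∣reach∣≤2 {x} x∈U = ℕ.≤-trans (p⊆q⇒∣p∣≤∣q∣ reach⊆new) (small-gains x)
        where
        O′ = Obs G (S ∪ ⁅ x ⁆)
        x∈O′ = z∈Obs∪⁅z⁆ S x
        observed : ∀ {y} → y ∈ U → Linked x y → y ∈ O′
        observed y∈U (inj₁ refl)       = x∈O′
        observed y∈U (inj₂ (inj₁ x~y)) = Adj⇒∈Obs∪⁅z⁆ S x~y
        -- x and y are then the only unobserved neighbours of w, so once x is observed, w forces y.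
        observed {y} y∈U (inj₂ (inj₂ (w , w∈O , w~x , w~y))) with y ≟ x
        ... | yes refl = x∈O′
        ... | no  y≢x  = Obs-forcingClosed (S ∪ ⁅ x ⁆) (Obs⊆Obs∪⁅z⁆ S x w∈O , w~y , others)
          where
          others : ∀ {w′} → Adj w w′ → w′ ≢ y → w′ ∈ O′
          others {w′} w~w′ w′≢y with w′ ∈? O
          ... | yes w′∈O = Obs⊆Obs∪⁅z⁆ S x w′∈O
          ... | no  w′∉O with ∣p∣≤2⇒z≡x⊎z≡y (∣neighboursIn∣≤2 w) (∈-neighboursIn⁺ w~x x∈U)
                                (∈-neighboursIn⁺ w~y y∈U) y≢x (∈-neighboursIn⁺ w~w′ (x∉p⇒x∈∁p w′∉O))
          ...   | inj₁ refl = x∈O′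
          ...   | inj₂ w′≡y = contradiction w′≡y w′≢y
        reach⊆new : reach x ⊆ newlyObserved S x
        reach⊆new y∈R with ∈-reach⁻ y∈R
        ... | y∈U , xy = x∈p∧x∉q⇒x∈p─q (observed y∈U xy) (x∈∁p⇒x∉p y∈U)

      reach-trans : ∀ {x t y} → x ∈ U → t ∈ reach x → y ∈ reach t → y ≢ t → y ∈ reach x
      reach-trans {x} {t} x∈U t∈Rx y∈Rt y≢t with ∈-reach⁻ t∈Rx | t ≟ x
      ... | _         | yes refl = y∈Rt
      ... | t∈U , x-t | no  t≢x
        with ∣p∣≤2⇒z≡x⊎z≡y (∣reach∣≤2 t∈U) (∈-reach⁺ t∈U (inj₁ refl)) (∈-reach⁺ x∈U (Linked-sym x-t)) (t≢x ∘ sym) y∈Rt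
      ...   | inj₁ y≡t = contradiction y≡t y≢t
      ...   | inj₂ refl = ∈-reach⁺ x∈U (inj₁ refl)

      reach-isFort : ∀ {x} → x ∈ U → IsFort G (reach x)
      reach-isFort {x} x∈U = (x , ∈-reach⁺ x∈U (inj₁ refl)) , no-single-neighbour
        where
        no-single-neighbour : ∀ v → v ∉ reach x → nbrsIn G (reach x) v ≢ 1
        no-single-neighbour v v∉R one with 0<∣p∣⇒Nonempty (ℕ.≤-reflexive (sym one))
        ... | t , t∈N with ∈-neighboursIn⁻ {reach x} {v} t∈N | v ∈? U
        ...   | v~t , t∈R | yes v∈U =
          v∉R (reach-trans x∈U t∈R (∈-reach⁺ v∈U (inj₂ (inj₁ (Adj-sym v~t)))) λ { refl → Adj-irrefl v~t })
        ...   | v~t , t∈R | no  v∉U with 2≤∣p∣⇒∃≢ 2≤∣N∣ (∈-neighboursIn⁺ v~t t∈U)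
          where
          t∈U = proj₁ (∈-reach⁻ t∈R)
          ∣N∣≢1 : nbrsIn G U v ≢ 1
          ∣N∣≢1 = proj₂ (∁Obs-isFort {S} (x∈∁p⇒x∉p x∈U)) v v∉U
          2≤∣N∣ = ℕ.≤∧≢⇒< (x∈p⇒0<∣p∣ (∈-neighboursIn⁺ v~t t∈U)) (∣N∣≢1 ∘ sym)
        ...     | y , y∈N , y≢t = y≢t (∣p∣≤1⇒x≡y (ℕ.≤-reflexive one) (∈-neighboursIn⁺ v~y y∈R) t∈N)
          where
          v~y = proj₁ (∈-neighboursIn⁻ {U} {v} y∈N)
          y∈U = proj₂ (∈-neighboursIn⁻ {U} {v} y∈N)
          y∈R = reach-trans x∈U t∈R (∈-reach⁺ y∈U (inj₂ (inj₂ (v , x∉∁p⇒x∈p v∉U , v~t , v~y)))) y≢t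

    three-newly-observed : (∀ F → IsFort G F → 3 ≤ ∣ F ∣) → ∀ {x} → x ∉ O → ∃ λ z → 3 ≤ ∣ newlyObserved S z ∣
    three-newly-observed forts≥3 {x} x∉O with any? (λ z → 3 ℕ.≤? ∣ newlyObserved S z ∣)
    ... | yes found = found
    ... | no  none  =
      contradiction (forts≥3 (reach x) (reach-isFort small-gains x∈U)) (ℕ.≤⇒≯ (∣reach∣≤2 small-gains x∈U))
      where
      x∈U = x∉p⇒x∈∁p x∉O
      small-gains : ∀ z → ∣ newlyObserved S z ∣ ≤ 2
      small-gains z = ℕ.≤-pred (ℕ.≰⇒> (λ 3≤ → none (z , 3≤)))

  ∣S∣≡0⇒∣∁Obs∣≡n : ∀ {S} → ∣ S ∣ ≡ 0 → ∣ ∁ (Obs G S) ∣ ≡ n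
  ∣S∣≡0⇒∣∁Obs∣≡n {S} ∣S∣≡0 = begin
    ∣ ∁ (Obs G S) ∣  ≡⟨ cong (∣_∣ ∘ ∁ ∘ Obs G) (∣p∣≡0⇒p≡⊥ {p = S} ∣S∣≡0) ⟩
    ∣ ∁ (Obs G ∅) ∣  ≡⟨ cong (∣_∣ ∘ ∁) Obs-⊥ ⟩
    ∣ ∁ ∅ ∣          ≡⟨ ∣∁p∣≡n∸∣p∣ ∅ ⟩
    n ∸ ∣ ∅ ∣        ≡⟨ cong (n ∸_) (∣⊥∣≡0 n) ⟩
    n                ∎
    where
    open ≡-Reasoning
    ∅ : Subset n
    ∅ = ⊥

  cost≡ : ∀ S β → cost G S β ≡ + ∣ S ∣ / 1 Q.+ β Q.* (+ ∣ ∁ (Obs G S) ∣ / 1)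
  cost≡ S β = cong (λ u → + ∣ S ∣ / 1 Q.+ β Q.* (+ u / 1)) (sym (∣∁p∣≡n∸∣p∣ (Obs G S)))

  cost-of-PDS : ∀ {S} β → IsPDS G S → cost G S β ≡ + ∣ S ∣ / 1
  cost-of-PDS {S} β pds = begin
    + ∣ S ∣ / 1 Q.+ β Q.* (+ (n ∸ ∣ Obs G S ∣) / 1)  ≡⟨ cong (λ u → + ∣ S ∣ / 1 Q.+ β Q.* (+ u / 1)) nothing-unobserved ⟩
    + ∣ S ∣ / 1 Q.+ β Q.* 0ℚ                         ≡⟨ cong (+ ∣ S ∣ / 1 Q.+_) (ℚ.*-zeroʳ β) ⟩
    + ∣ S ∣ / 1 Q.+ 0ℚ                               ≡⟨ ℚ.+-identityʳ (+ ∣ S ∣ / 1) ⟩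
    + ∣ S ∣ / 1                                      ∎
    where
    open ≡-Reasoning
    nothing-unobserved : n ∸ ∣ Obs G S ∣ ≡ 0
    nothing-unobserved =
      trans (cong (λ O → n ∸ ∣ O ∣) (IsPDS⇒Obs≡⊤ {S} pds)) (trans (cong (n ∸_) (∣⊤∣≡n n)) (ℕ.n∸n≡0 n))

  module _ {f γ : ℕ} (forts≥f : ∀ F → IsFort G F → f ≤ ∣ F ∣) (3≤f : 3 ≤ f)
           (pds≥γ : ∀ S → IsPDS G S → γ ≤ ∣ S ∣) where

    non-PDS-bound : ∀ S → ¬ IsPDS G S → 3 * γ + f ≤ 3 * suc ∣ S ∣ + ∣ ∁ (Obs G S) ∣
    non-PDS-bound S ¬pds = <-rec Bound bound _ S refl ¬pds
      where
      Bound : ℕ → Set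
      Bound u = ∀ S → ∣ ∁ (Obs G S) ∣ ≡ u → ¬ IsPDS G S → 3 * γ + f ≤ 3 * suc ∣ S ∣ + u
      bound : ∀ u → (∀ {u′} → u′ < u → Bound u′) → Bound u
      bound _ rec S refl ¬pds with ¬IsPDS⇒∃∉Obs S ¬pds
      ... | x , x∉O with three-newly-observed S (λ F F-fort → ℕ.≤-trans 3≤f (forts≥f F F-fort)) x∉O
      ...   | z , 3≤gain with isPDS? (S ∪ ⁅ z ⁆)
      ...     | yes pds′ = ℕ.+-mono-≤ (ℕ.*-monoʳ-≤ 3 γ≤1+∣S∣) f≤u
        where
        γ≤1+∣S∣ = ℕ.≤-trans (pds≥γ (S ∪ ⁅ z ⁆) pds′) (∣p∪⁅x⁆∣≤1+∣p∣ S z)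
        f≤u : f ≤ ∣ ∁ (Obs G S) ∣
        f≤u = forts≥f _ (∁Obs-isFort {S} x∉O)
      ...     | no  ¬pds′ =
        ℕ.≤-trans (rec u′<u (S ∪ ⁅ z ⁆) refl ¬pds′) (3[1+s′]+u′≤3[1+s]+u (∣p∪⁅x⁆∣≤1+∣p∣ S z) 3+u′≤u)
        where
        u′ = ∣ ∁ (Obs G (S ∪ ⁅ z ⁆)) ∣
        3+u′≤u : 3 + u′ ≤ ∣ ∁ (Obs G S) ∣
        3+u′≤u = ℕ.≤-trans (ℕ.≤-reflexive (ℕ.+-comm 3 u′))
                   (ℕ.≤-trans (ℕ.+-monoʳ-≤ u′ 3≤gain) (ℕ.≤-reflexive (∣∁Obs∪⁅z⁆∣+∣newlyObserved∣≡∣∁Obs∣ S z)))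
        u′<u : u′ < ∣ ∁ (Obs G S) ∣
        u′<u = ℕ.≤-trans (ℕ.m≤n+m (suc u′) 2) 3+u′≤u

    module _ {β : ℚ} (β≥max : threshold f γ ⊔ frac γ n Q.≤ β) where
      private
        threshold≤β : threshold f γ Q.≤ β
        threshold≤β = ℚ.p⊔q≤r⇒p≤r (threshold f γ) (frac γ n) β≥max
        γ/n≤β : frac γ n Q.≤ β
        γ/n≤β = ℚ.p⊔q≤r⇒q≤r (threshold f γ) (frac γ n) β≥max
        0≤β : 0ℚ Q.≤ β
        0≤β = ℚ.≤-trans (frac-nonNeg γ n) γ/n≤β

      γ≤size+β*unobserved : ∀ S → + γ / 1 Q.≤ + ∣ S ∣ / 1 Q.+ β Q.* (+ ∣ ∁ (Obs G S) ∣ / 1)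
      γ≤size+β*unobserved S with isPDS? S
      ... | yes pds = a≤k⇒a≤k+βu {u = ∣ ∁ (Obs G S) ∣} (pds≥γ S pds) 0≤β
      ... | no ¬pds with ¬IsPDS⇒∃∉Obs S ¬pds | ∣ S ∣ in ∣S∣≡
      ...   | x , _ | zero  = subst (λ u → + γ / 1 Q.≤ + 0 / 1 Q.+ β Q.* (+ u / 1)) (sym (∣S∣≡0⇒∣∁Obs∣≡n {S} ∣S∣≡))
                                    (a/u≤β⇒a≤0+βu {{nonZeroIndex x}} γ/n≤β)
      ...   | _     | suc k =
        threshold≤β⇒γ≤k+βu {f} {γ} {suc k} {∣ ∁ (Obs G S) ∣} 3≤f (s≤s z≤n) size-bound 0≤β threshold≤β
        where
        size-bound : 3 * γ + f ≤ 3 * suc (suc k) + ∣ ∁ (Obs G S) ∣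
        size-bound = subst (λ s → 3 * γ + f ≤ 3 * suc s + ∣ ∁ (Obs G S) ∣) ∣S∣≡ (non-PDS-bound S ¬pds)

proposition3p9 : (n : ℕ) (G : Graph n) (f γ : ℕ) (β : ℚ)
    → IsMinFortSize G f → IsPowerDomNumber G γ → 3 ≤ f
    → ((frac 1 3 - frac (f ∸ 3) (3 * ((f + 3 * γ) ∸ 6))) ⊔ frac γ n) Q.≤ β
    → (S : Subset n) → IsMinPDS G S → IsBetaBest G β S
proposition3p9 n G f γ β (_ , forts≥f) ((S₀ , S₀-pds , ∣S₀∣≡γ) , pds≥γ) 3≤f β≥max S (S-pds , S-min) S′ = begin
  cost G S β                                         ≡⟨ cost-of-PDS G {S} β S-pds ⟩
  + ∣ S ∣ / 1                                        ≡⟨ cong (λ k → + k / 1) ∣S∣≡γ ⟩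
  + γ / 1                                            ≤⟨ γ≤size+β*unobserved G forts≥f 3≤f pds≥γ β≥max S′ ⟩
  + ∣ S′ ∣ / 1 Q.+ β Q.* (+ ∣ ∁ (Obs G S′) ∣ / 1)  ≡⟨ cost≡ G S′ β ⟨
  cost G S′ β                                        ∎
  where
  open ℚ.≤-Reasoning
  ∣S∣≡γ : ∣ S ∣ ≡ γ
  ∣S∣≡γ = ℕ.≤-antisym (subst (∣ S ∣ ≤_) ∣S₀∣≡γ (S-min S₀ S₀-pds)) (pds≥γ S S-pds)
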